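{- No paperfolding sequence contains a reflected factor of length greater than $13$; that is, for every paperfolding sequence $\mathbf{p}$ and every factor $w$ of $\mathbf{p}$ with $|w|>13$, the word $w^R$ is not a factor of $\mathbf{p}$.
   Context: Let $E$ be the morphism on $\{0,1\}^*$ exchanging $0$ and $1$, and for $u=u(1)\cdots u(m)$ let $u^R=u(m)\cdots u(1)$. Given an infinite sequence $\mathbf{f}=f_0f_1f_2\cdots$ of binary unfolding instructions, define finite words by $p_{\varepsilon}=\varepsilon$ and $p_{f_0\cdots f_{i+1}} = p_{f_0\cdots f_i}\, f_{i+1}\, E(p_{f_0\cdots f_i}^R)$ (so $p_{f_0}=f_0$); each is a prefix of the next, and their limit is the paperfolding sequence $\mathbf{p}_{\mathbf{f}}$. A paperfolding sequence is any $\mathbf{p}_{\mathbf{f}}$. A factor is a finite contiguous block; a factor $w$ is reflected if $w^R$ is also a factor. -}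

module Defs where

open import Data.Bool using (Bool; not; false)
open import Data.Nat using (ℕ; zero; suc; _+_)
open import Data.List using (List; []; _∷_; _++_; map; reverse; length)
open import Data.Product using (∃)
open import Relation.Binary.PropositionalEquality using (_≡_)

-- Binary alphabet {0,1} is rendered as Bool (false = 0, true = 1).
Word : Set
Word = List Bool

E : Word → Word
E = map not

Instructions : Set
Instructions = ℕ → Bool

-- pfWord f n = p_{f₀⋯f_{n-1}}  (pfWord f 0 = ε)
pfWord : Instructions → ℕ → Word
pfWord f zero    = []
pfWord f (suc n) = pfWord f n ++ (f n ∷ E (reverse (pfWord f n)))

-- k-th letter of a finite word (default false if out of range; never used
-- out of range below since |p_{f₀⋯f_k}| = 2^{k+1} - 1 > k).
letterAt : Word → ℕ → Bool
letterAt []       _       = false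
letterAt (x ∷ xs) zero    = x
letterAt (x ∷ xs) (suc k) = letterAt xs k

-- The paperfolding sequence p_f as the limit of the prefixes p_{f₀⋯f_n}:
-- its k-th letter is the k-th letter of p_{f₀⋯f_k}.
paperfolding : Instructions → ℕ → Bool
paperfolding f k = letterAt (pfWord f (suc k)) k

window : (ℕ → Bool) → ℕ → ℕ → Word
window s i zero    = []
window s i (suc m) = s i ∷ window s (suc i) m

IsFactor : (ℕ → Bool) → Word → Set
IsFactor s w = ∃ λ i → window s i (length w) ≡ w

{-# OPTIONS --safe #-}
-- The paperfolding sequence is a Toeplitz sequence: p_{f₀f₁⋯} carries the alternating
-- sequence f₀ (¬f₀) f₀ (¬f₀) ⋯ at its even positions and p_{f₁f₂⋯} at its odd positions.
-- Halving four times (14 → 7 → 4 → 2 → 1), a factor of length 14 is therefore determined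
-- by f₀ ⋯ f₃, the five lowest binary digits of its position and one letter of p_{f₄f₅⋯}.
-- Running through these 16 · 64 · 64 possibilities shows that no factor of length 14 is the
-- reverse of another one, and a longer reflected factor would have a reflected prefix of length 14.

module Submission where

open import Defs
open import Data.Nat using (_<_)
open import Data.List using (length; reverse)
open import Relation.Nullary using (¬_)

open import Data.Bool using (Bool; true; false; not; _xor_; _∧_)
open import Data.Bool.Properties using (not-involutive; ∧-conicalˡ; ∧-conicalʳ; T-≡) renaming (_≟_ to _≟ᴮ_)
open import Data.List using (List; []; _∷_; [_]; _++_; take; drop)
open import Data.List.Properties
  using (∷-injective; ≡-dec; length-++; length-++-≤ˡ; length-++-sucʳ; ++-assoc; ++-identityʳ;
         reverse-++; unfold-reverse; length-reverse; reverse-involutive; length-take; take++drop≡id)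
open import Data.Nat using (ℕ; zero; suc; _+_; _∸_; _≤_; z≤n; s≤s)
open import Data.Nat.Properties using (≤-refl; ≤-trans; n≤1+n; +-suc; m∸n+n≡m; m≤n⇒m⊓n≡m; suc-injective; module ≤-Reasoning)
open import Data.Product using (_×_; _,_; proj₁; proj₂; map₁; ∃; ∃₂)
open import Data.Vec using (Vec; []; _∷_; _∷ʳ_)
open import Function using (_∘_; Equivalence)
open import Relation.Binary.Definitions using (DecidableEquality)
open import Relation.Binary.PropositionalEquality
  using (_≡_; _≢_; refl; sym; trans; cong; cong₂; subst; module ≡-Reasoning)
open import Relation.Nullary.Decidable using (isNo; toWitnessFalse)

window-++ : ∀ s i m n → window s i (m + n) ≡ window s i m ++ window s (m + i) n
window-++ s i zero    n = refl
window-++ s i (suc m) n = cong (s i ∷_) (trans (window-++ s (suc i) m n)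
  (cong (λ k → window s (suc i) m ++ window s k n) (+-suc m i)))

length-window : ∀ s i n → length (window s i n) ≡ n
length-window s i zero    = refl
length-window s i (suc n) = cong suc (length-window s (suc i) n)

++-injective : ∀ {A : Set} {xs ys xs′ ys′ : List A} →
               length xs ≡ length ys → xs ++ xs′ ≡ ys ++ ys′ → xs ≡ ys × xs′ ≡ ys′
++-injective {xs = []}     {[]}     _   eq = refl , eq
++-injective {xs = x ∷ xs} {y ∷ ys} len eq with ∷-injective eq
... | refl , eq′ = map₁ (cong (x ∷_)) (++-injective (suc-injective len) eq′)

IsFactor-++ : ∀ {s} u v → IsFactor s (u ++ v) → IsFactor s u × IsFactor s v
IsFactor-++ {s} u v (i , eq) = (i , proj₁ split) , (length u + i , proj₂ split)
  where
  open ≡-Reasoning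
  split : window s i (length u) ≡ u × window s (length u + i) (length v) ≡ v
  split = ++-injective (length-window s i (length u)) (begin
    window s i (length u) ++ window s (length u + i) (length v) ≡⟨ window-++ s i (length u) (length v) ⟨
    window s i (length u + length v)                            ≡⟨ cong (window s i) (length-++ u) ⟨
    window s i (length (u ++ v))                                ≡⟨ eq ⟩
    u ++ v                                                      ∎)

Reflected : (ℕ → Bool) → Word → Set
Reflected s w = IsFactor s w × IsFactor s (reverse w)

Reflected-++ˡ : ∀ {s} u v → Reflected s (u ++ v) → Reflected s u
Reflected-++ˡ u v (uv , uvᴿ) =
  proj₁ (IsFactor-++ u v uv) ,
  proj₂ (IsFactor-++ (reverse v) (reverse u) (subst (IsFactor _) (reverse-++ u v) uvᴿ))

double : ℕ → ℕ
double zero    = zero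
double (suc n) = suc (suc (double n))

m≤double : ∀ m → m ≤ double m
m≤double zero    = z≤n
m≤double (suc m) = s≤s (≤-trans (m≤double m) (n≤1+n _))

infixl 6 _*2+_
_*2+_ : ℕ → Bool → ℕ
j *2+ false = double j
j *2+ true  = suc (double j)

*2+-surjective : ∀ i → ∃₂ λ j r → j *2+ r ≡ i
*2+-surjective zero = zero , false , refl
*2+-surjective (suc i) with *2+-surjective i
... | j , false , refl = j , true , refl
... | j , true  , refl = suc j , false , refl

appendBits : ∀ {k} → ℕ → Vec Bool k → ℕ
appendBits j []       = j
appendBits j (r ∷ rs) = appendBits j rs *2+ r

appendBits-surjective : ∀ k i → ∃₂ λ j (rs : Vec Bool k) → appendBits j rs ≡ i
appendBits-surjective zero    i = i , [] , refl
appendBits-surjective (suc k) i with *2+-surjective i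
... | i₁ , r , refl with appendBits-surjective k i₁
... | j , rs , refl = j , r ∷ rs , refl

alternating : Bool → ℕ → Bool
alternating a zero    = a
alternating a (suc m) = alternating (not a) m

alternating-not : ∀ a m → alternating (not a) m ≡ not (alternating a m)
alternating-not a zero    = refl
alternating-not a (suc m) = alternating-not (not a) m

alternating-involutive : ∀ a m → alternating (alternating a m) m ≡ a
alternating-involutive a zero    = refl
alternating-involutive a (suc m) = begin
  alternating (not (alternating (not a) m)) m ≡⟨ alternating-not (alternating (not a) m) m ⟩
  not (alternating (alternating (not a) m) m) ≡⟨ cong not (alternating-involutive (not a) m) ⟩
  not (not a)                                 ≡⟨ not-involutive a ⟩
  a                                           ∎
  where open ≡-Reasoning

alternating-double : ∀ a j → alternating a (double j) ≡ a
alternating-double a zero    = refl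
alternating-double a (suc j) = trans (alternating-double (not (not a)) j) (not-involutive a)

alternating-*2+ : ∀ a j r → alternating a (j *2+ r) ≡ r xor a
alternating-*2+ a j false = alternating-double a j
alternating-*2+ a j true  = alternating-double (not a) j

interleave : Bool → Word → Word
interleave a []       = [ a ]
interleave a (x ∷ xs) = a ∷ x ∷ interleave (not a) xs

interleave-++-∷ : ∀ a xs y ys →
  interleave a xs ++ y ∷ interleave (alternating (not a) (length xs)) ys ≡ interleave a (xs ++ y ∷ ys)
interleave-++-∷ a []       y ys = refl
interleave-++-∷ a (x ∷ xs) y ys = cong (λ zs → a ∷ x ∷ zs) (interleave-++-∷ (not a) xs y ys)

E-interleave : ∀ a xs → E (interleave a xs) ≡ interleave (not a) (E xs)
E-interleave a []       = refl
E-interleave a (x ∷ xs) = cong (λ zs → not a ∷ not x ∷ zs) (E-interleave (not a) xs)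

reverse-interleave : ∀ a xs → reverse (interleave a xs) ≡ interleave (alternating a (length xs)) (reverse xs)
reverse-interleave a []       = refl
reverse-interleave a (x ∷ xs) = begin
  reverse (a ∷ x ∷ interleave (not a) xs)        ≡⟨ reverse-++ (a ∷ x ∷ []) (interleave (not a) xs) ⟩
  reverse (interleave (not a) xs) ++ x ∷ a ∷ []  ≡⟨ cong (_++ x ∷ a ∷ []) (reverse-interleave (not a) xs) ⟩
  interleave c (reverse xs) ++ x ∷ a ∷ []        ≡⟨ cong (λ b → interleave c (reverse xs) ++ x ∷ b ∷ []) last-colour ⟨
  interleave c (reverse xs) ++ x ∷ interleave (alternating (not c) (length (reverse xs))) []
                                                 ≡⟨ interleave-++-∷ c (reverse xs) x [] ⟩
  interleave c (reverse xs ++ [ x ])             ≡⟨ cong (interleave c) (unfold-reverse x xs) ⟨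
  interleave c (reverse (x ∷ xs))                ∎
  where
  open ≡-Reasoning
  c : Bool
  c = alternating (not a) (length xs)
  last-colour : alternating (not c) (length (reverse xs)) ≡ a
  last-colour = begin
    alternating (not c) (length (reverse xs)) ≡⟨ cong (alternating (not c)) (length-reverse xs) ⟩
    alternating (not c) (length xs)           ≡⟨ alternating-not c (length xs) ⟩
    not (alternating c (length xs))           ≡⟨ cong not (alternating-involutive (not a) (length xs)) ⟩
    not (not a)                               ≡⟨ not-involutive a ⟩
    a                                         ∎

shift : Instructions → Instructions
shift f = f ∘ suc

pfWord-interleave : ∀ f n → pfWord f (suc n) ≡ interleave (f 0) (pfWord (shift f) n)
pfWord-interleave f zero    = refl
pfWord-interleave f (suc n) = begin
  pfWord f (suc n) ++ f (suc n) ∷ E (reverse (pfWord f (suc n)))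
    ≡⟨ cong (λ p → p ++ f (suc n) ∷ E (reverse p)) (pfWord-interleave f n) ⟩
  interleave a p ++ f (suc n) ∷ E (reverse (interleave a p))
    ≡⟨ cong (λ q → interleave a p ++ f (suc n) ∷ q) E-reverse ⟩
  interleave a p ++ f (suc n) ∷ interleave (alternating (not a) (length p)) (E (reverse p))
    ≡⟨ interleave-++-∷ a p (f (suc n)) (E (reverse p)) ⟩
  interleave a (p ++ f (suc n) ∷ E (reverse p))
    ∎
  where
  open ≡-Reasoning
  a : Bool
  a = f 0
  p : Word
  p = pfWord (shift f) n
  E-reverse : E (reverse (interleave a p)) ≡ interleave (alternating (not a) (length p)) (E (reverse p))
  E-reverse = begin
    E (reverse (interleave a p))                                ≡⟨ cong E (reverse-interleave a p) ⟩
    E (interleave (alternating a (length p)) (reverse p))       ≡⟨ E-interleave _ (reverse p) ⟩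
    interleave (not (alternating a (length p))) (E (reverse p)) ≡⟨ cong (λ b → interleave b (E (reverse p))) (alternating-not a (length p)) ⟨
    interleave (alternating (not a) (length p)) (E (reverse p)) ∎

letterAt-++ˡ : ∀ xs ys k → k < length xs → letterAt (xs ++ ys) k ≡ letterAt xs k
letterAt-++ˡ (x ∷ xs) ys zero    _         = refl
letterAt-++ˡ (x ∷ xs) ys (suc k) (s≤s k<n) = letterAt-++ˡ xs ys k k<n

letterAt-interleave-even : ∀ a xs m → m ≤ length xs → letterAt (interleave a xs) (m *2+ false) ≡ alternating a m
letterAt-interleave-even a []       zero    _         = refl
letterAt-interleave-even a (x ∷ xs) zero    _         = refl
letterAt-interleave-even a (x ∷ xs) (suc m) (s≤s m≤n) = letterAt-interleave-even (not a) xs m m≤n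

letterAt-interleave-odd : ∀ a xs m → m < length xs → letterAt (interleave a xs) (m *2+ true) ≡ letterAt xs m
letterAt-interleave-odd a (x ∷ xs) zero    _         = refl
letterAt-interleave-odd a (x ∷ xs) (suc m) (s≤s m<n) = letterAt-interleave-odd (not a) xs m m<n

n≤length-pfWord : ∀ f n → n ≤ length (pfWord f n)
n≤length-pfWord f zero    = z≤n
n≤length-pfWord f (suc n) = begin
  suc n                 ≤⟨ s≤s (n≤length-pfWord f n) ⟩
  suc (length p)        ≤⟨ s≤s (length-++-≤ˡ p) ⟩
  suc (length (p ++ q)) ≡⟨ length-++-sucʳ p (f n) q ⟨
  length (p ++ f n ∷ q) ∎
  where
  open ≤-Reasoning
  p q : Word
  p = pfWord f n
  q = E (reverse p)

pfWord-prefix : ∀ f d n → ∃ λ ys → pfWord f (d + n) ≡ pfWord f n ++ ys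
pfWord-prefix f zero    n = [] , sym (++-identityʳ (pfWord f n))
pfWord-prefix f (suc d) n with pfWord-prefix f d n
... | ys , eq = ys ++ q , trans (cong (_++ q) eq) (++-assoc (pfWord f n) ys q)
  where
  q : Word
  q = f (d + n) ∷ E (reverse (pfWord f (d + n)))

letterAt-pfWord : ∀ f {k n} → k < n → letterAt (pfWord f n) k ≡ paperfolding f k
letterAt-pfWord f {k} {n} k<n with pfWord-prefix f (n ∸ suc k) (suc k)
... | ys , eq = begin
  letterAt (pfWord f n) k                   ≡⟨ cong (λ m → letterAt (pfWord f m) k) (m∸n+n≡m k<n) ⟨
  letterAt (pfWord f (n ∸ suc k + suc k)) k ≡⟨ cong (λ w → letterAt w k) eq ⟩
  letterAt (pfWord f (suc k) ++ ys) k       ≡⟨ letterAt-++ˡ (pfWord f (suc k)) ys k (n≤length-pfWord f (suc k)) ⟩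
  paperfolding f k                          ∎
  where open ≡-Reasoning

paperfolding-even : ∀ f j → paperfolding f (j *2+ false) ≡ alternating (f 0) j
paperfolding-even f j = begin
  letterAt (pfWord f (suc (double j))) (double j)
    ≡⟨ cong (λ w → letterAt w (double j)) (pfWord-interleave f (double j)) ⟩
  letterAt (interleave (f 0) (pfWord (shift f) (double j))) (double j)
    ≡⟨ letterAt-interleave-even (f 0) (pfWord (shift f) (double j)) j j≤length ⟩
  alternating (f 0) j
    ∎
  where
  open ≡-Reasoning
  j≤length : j ≤ length (pfWord (shift f) (double j))
  j≤length = ≤-trans (m≤double j) (n≤length-pfWord (shift f) (double j))

paperfolding-odd : ∀ f j → paperfolding f (j *2+ true) ≡ paperfolding (shift f) j
paperfolding-odd f j = begin
  letterAt (pfWord f (suc (suc (double j)))) (suc (double j))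
    ≡⟨ cong (λ w → letterAt w (suc (double j))) (pfWord-interleave f (suc (double j))) ⟩
  letterAt (interleave (f 0) (pfWord (shift f) (suc (double j)))) (suc (double j))
    ≡⟨ letterAt-interleave-odd (f 0) (pfWord (shift f) (suc (double j))) j j<length ⟩
  letterAt (pfWord (shift f) (suc (double j))) j
    ≡⟨ letterAt-pfWord (shift f) (s≤s (m≤double j)) ⟩
  paperfolding (shift f) j
    ∎
  where
  open ≡-Reasoning
  j<length : j < length (pfWord (shift f) (suc (double j)))
  j<length = ≤-trans (s≤s (m≤double j)) (n≤length-pfWord (shift f) (suc (double j)))

-- weave r c n (w₀ w₁ w₂ ⋯) is the factor of length n of  c w₀ (not c) w₁ c w₂ ⋯  starting at
-- position 0 if r = false and at position 1 if r = true.
weave : Bool → Bool → ℕ → Word → Word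
weave false c (suc n) ws       = c ∷ weave true c n ws
weave true  c (suc n) (w ∷ ws) = w ∷ weave false (not c) n ws
weave _     _ _       _        = []

module _ {s t : ℕ → Bool} {a : Bool}
         (s-even : ∀ j → s (j *2+ false) ≡ alternating a j)
         (s-odd  : ∀ j → s (j *2+ true) ≡ t j) where

  mutual
    window-even : ∀ j {n m} → n ≤ suc (double m) →
                  window s (j *2+ false) n ≡ weave false (alternating a j) n (window t j m)
    window-even j {zero}  _          = refl
    window-even j {suc n} (s≤s n≤2m) = cong₂ _∷_ (s-even j) (window-odd j n≤2m)

    window-odd : ∀ j {n m} → n ≤ double m →
                 window s (j *2+ true) n ≡ weave true (alternating a j) n (window t j m)
    window-odd j {zero}          _            = refl
    window-odd j {suc n} {zero}  ()
    window-odd j {suc n} {suc m} (s≤s n≤1+2m) = cong₂ _∷_ (s-odd j) (begin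
      window s (suc j *2+ false) n                               ≡⟨ window-even (suc j) n≤1+2m ⟩
      weave false (alternating (not a) j) n (window t (suc j) m) ≡⟨ cong (λ c → weave false c n (window t (suc j) m)) (alternating-not a j) ⟩
      weave false (not (alternating a j)) n (window t (suc j) m) ∎)
      where open ≡-Reasoning

  window-*2+ : ∀ j r {n m} → n ≤ double m → window s (j *2+ r) n ≡ weave r (alternating a j) n (window t j m)
  window-*2+ j false n≤2m = window-even j (≤-trans n≤2m (n≤1+n _))
  window-*2+ j true  n≤2m = window-odd j n≤2m

window-paperfolding : ∀ f j r′ r n m → n ≤ double m →
  window (paperfolding f) (j *2+ r′ *2+ r) n ≡ weave r (r′ xor f 0) n (window (paperfolding (shift f)) (j *2+ r′) m)
window-paperfolding f j r′ r n m n≤2m = begin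
  window (paperfolding f) (j *2+ r′ *2+ r) n
    ≡⟨ window-*2+ (paperfolding-even f) (paperfolding-odd f) (j *2+ r′) r n≤2m ⟩
  weave r (alternating (f 0) (j *2+ r′)) n (window (paperfolding (shift f)) (j *2+ r′) m)
    ≡⟨ cong (λ c → weave r c n (window (paperfolding (shift f)) (j *2+ r′) m)) (alternating-*2+ (f 0) j r′) ⟩
  weave r (r′ xor f 0) n (window (paperfolding (shift f)) (j *2+ r′) m)
    ∎
  where open ≡-Reasoning

-- The factor of length 14 of p_{f₀f₁⋯} at a position whose binary digits end in r₄ ⋯ r₀,
-- where b is the letter of p_{f₄f₅⋯} reached after four halvings.
foldedWindow : Vec Bool 4 → Vec Bool 6 → Word
foldedWindow (f₀ ∷ f₁ ∷ f₂ ∷ f₃ ∷ []) (r₀ ∷ r₁ ∷ r₂ ∷ r₃ ∷ r₄ ∷ b ∷ []) =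
  weave r₀ (r₁ xor f₀) 14 (weave r₁ (r₂ xor f₁) 7 (weave r₂ (r₃ xor f₂) 4 (weave r₃ (r₄ xor f₃) 2 [ b ])))

window-appendBits : ∀ f j rs → ∃ λ b →
  window (paperfolding f) (appendBits j rs) 14 ≡ foldedWindow (f 0 ∷ f 1 ∷ f 2 ∷ f 3 ∷ []) (rs ∷ʳ b)
window-appendBits f j rs@(r₀ ∷ r₁ ∷ r₂ ∷ r₃ ∷ r₄ ∷ []) =
  paperfolding (shift (shift (shift (shift f)))) (j *2+ r₄) ,
  trans (cong (λ k → window (paperfolding f) k 14) digits) (
  trans (window-paperfolding f                         (j *2+ r₄ *2+ r₃ *2+ r₂) r₁ r₀ 14 7 ≤-refl)    (cong (weave r₀ _ 14) (
  trans (window-paperfolding (shift f)                 (j *2+ r₄ *2+ r₃)       r₂ r₁  7 4 (n≤1+n 7)) (cong (weave r₁ _ 7) (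
  trans (window-paperfolding (shift (shift f))         (j *2+ r₄)              r₃ r₂  4 2 ≤-refl)    (cong (weave r₂ _ 4) (
        window-paperfolding (shift (shift (shift f))) j                        r₄ r₃  2 1 ≤-refl)))))))
  where
  -- Passing through this equation keeps both windows syntactically equal; comparing them by
  -- evaluation would unfold the fourteen letters into pfWord, which doubles in size at each step.
  digits : appendBits j rs ≡ j *2+ r₄ *2+ r₃ *2+ r₂ *2+ r₁ *2+ r₀
  digits = refl

window-folded : ∀ f i → ∃ λ x → window (paperfolding f) i 14 ≡ foldedWindow (f 0 ∷ f 1 ∷ f 2 ∷ f 3 ∷ []) x
window-folded f i =
  let j , rs , j·rs≡i = appendBits-surjective 5 i
      b , folded      = window-appendBits f j rs
  in rs ∷ʳ b , trans (cong (λ k → window (paperfolding f) k 14) (sym j·rs≡i)) folded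

allVec : ∀ {n} → (Vec Bool n → Bool) → Bool
allVec {zero}  p = p []
allVec {suc n} p = allVec (p ∘ (false ∷_)) ∧ allVec (p ∘ (true ∷_))

allVec-sound : ∀ {n} p → allVec {n} p ≡ true → ∀ v → p v ≡ true
allVec-sound p h []          = h
allVec-sound p h (false ∷ v) = allVec-sound (p ∘ (false ∷_)) (∧-conicalˡ _ _ h) v
allVec-sound p h (true  ∷ v) = allVec-sound (p ∘ (true ∷_))  (∧-conicalʳ _ _ h) v

_≟ʷ_ : DecidableEquality Word
_≟ʷ_ = ≡-dec _≟ᴮ_

differsFromReverse : Vec Bool 4 → Vec Bool 6 → Vec Bool 6 → Bool
differsFromReverse fs x y = isNo (foldedWindow fs x ≟ʷ reverse (foldedWindow fs y))

noFoldedReflection : Vec Bool 4 → Bool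
noFoldedReflection fs = allVec λ x → allVec (differsFromReverse fs x)

-- Stated with ≡ true rather than T: Agda would re-evaluate the closed type T (allVec …)
-- whenever it is compared with another type.
all-noFoldedReflection : allVec noFoldedReflection ≡ true
all-noFoldedReflection = refl

foldedWindow-not-reflected : ∀ fs x y → foldedWindow fs x ≢ reverse (foldedWindow fs y)
foldedWindow-not-reflected fs x y = toWitnessFalse {a? = foldedWindow fs x ≟ʷ reverse (foldedWindow fs y)}
  (Equivalence.from T-≡
    (allVec-sound (differsFromReverse fs x)
      (allVec-sound (λ x → allVec (differsFromReverse fs x))
        (allVec-sound noFoldedReflection all-noFoldedReflection fs) x) y))

length≡14⇒¬Reflected : ∀ f u → length u ≡ 14 → ¬ Reflected (paperfolding f) u
length≡14⇒¬Reflected f u |u|≡14 ((i , wᵢ) , (j , wⱼ)) =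
  let x , foldedᵢ = window-folded f i
      y , foldedⱼ = window-folded f j
  in foldedWindow-not-reflected fs x y (begin
    foldedWindow fs x                                        ≡⟨ foldedᵢ ⟨
    window (paperfolding f) i 14                             ≡⟨ cong (window (paperfolding f) i) |u|≡14 ⟨
    window (paperfolding f) i (length u)                     ≡⟨ wᵢ ⟩
    u                                                        ≡⟨ reverse-involutive u ⟨
    reverse (reverse u)                                      ≡⟨ cong reverse wⱼ ⟨
    reverse (window (paperfolding f) j (length (reverse u))) ≡⟨ cong (reverse ∘ window (paperfolding f) j) |uᴿ|≡14 ⟩
    reverse (window (paperfolding f) j 14)                   ≡⟨ cong reverse foldedⱼ ⟩
    reverse (foldedWindow fs y)                              ∎)
  where
  open ≡-Reasoning
  fs : Vec Bool 4
  fs = f 0 ∷ f 1 ∷ f 2 ∷ f 3 ∷ []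
  |uᴿ|≡14 : length (reverse u) ≡ 14
  |uᴿ|≡14 = trans (length-reverse u) |u|≡14

proposition8p3 : ∀ (f : Instructions) (w : Word) →
    13 < length w → IsFactor (paperfolding f) w →
    ¬ IsFactor (paperfolding f) (reverse w)
proposition8p3 f w 13<|w| w-factor wᴿ-factor =
  length≡14⇒¬Reflected f (take 14 w) (trans (length-take 14 w) (m≤n⇒m⊓n≡m 13<|w|))
    (Reflected-++ˡ (take 14 w) (drop 14 w)
      (subst (Reflected (paperfolding f)) (sym (take++drop≡id 14 w)) (w-factor , wᴿ-factor)))
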